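{- For integers $0\le m<n$, \[\mathcal{C}_{n,m}=\frac{n(2m+1)}{(n-m)(m+1)}\sum_{k=0}^{n-m-1}\mathcal{C}_{k+m,m}\,\mathcal{C}_{n-m-k-1,0}.\]
   Context: A path is a finite sequence of points of $\mathbb{Z}^2$ in which each step is $(1,0)$ or $(0,1)$. For integers $0\le m\le n$, $\mathcal{C}_{n,m}$ denotes the number of paths from $(0,-2m)$ to $(n-m,n-m)$ not crossing the line $y=x$, i.e. all of whose points $(p,q)$ satisfy $q\le p$. (So $\mathcal{C}_{n,0}$ is the classical Catalan number.) -}

module Defs where

open import Data.Bool using (Bool; true; false; _∧_)
open import Data.Nat using (ℕ; zero; suc)
open import Data.Integer using (ℤ; +_; -_; _+_; _-_; _≤ᵇ_; ∣_∣)
open import Data.Integer.Properties using (_≟_)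
open import Data.List using (List; []; _∷_; _++_; map; length; filterᵇ)
open import Relation.Nullary.Decidable using (⌊_⌋)

-- A step of a path: true = (1,0), false = (0,1).
Step : Set
Step = Bool

allSteps : ℕ → List (List Step)
allSteps zero    = [] ∷ []
allSteps (suc l) = map (true ∷_) (allSteps l) ++ map (false ∷_) (allSteps l)

goodPath : ℤ → ℤ → List Step → ℤ → ℤ → Bool
goodPath p q []            tp tq = (q ≤ᵇ p) ∧ ⌊ p ≟ tp ⌋ ∧ ⌊ q ≟ tq ⌋
goodPath p q (true  ∷ ss)  tp tq = (q ≤ᵇ p) ∧ goodPath (p + + 1) q ss tp tq
goodPath p q (false ∷ ss)  tp tq = (q ≤ᵇ p) ∧ goodPath p (q + + 1) ss tp tq

-- Every path with unit steps (1,0),(0,1) from s to t has exactly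
-- (tp - sp) + (tq - sq) steps, so enumerating sequences of that length
-- enumerates all such paths (and each path is determined by its steps).
belowPathCount : ℤ → ℤ → ℤ → ℤ → ℕ
belowPathCount sp sq tp tq =
  length (filterᵇ (λ ss → goodPath sp sq ss tp tq)
                  (allSteps ∣ (tp - sp) + (tq - sq) ∣))

-- 𝒞_{n,m}: paths from (0, -2m) to (n-m, n-m) not crossing y = x.
-- (Intended for 0 ≤ m ≤ n; n - m is an integer difference.)
𝒞 : ℕ → ℕ → ℕ
𝒞 n m = belowPathCount (+ 0) (- (+ (2 Data.Nat.* m))) (+ n - + m) (+ n - + m)

-- Let ballot u h be the number of paths from (0 , -h) to (u , u) that never cross y = x, so
-- that 𝒞 n m = ballot (n - m) (2m) and 𝒞 k 0 = ballot k 0 is the Catalan number. Cutting a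
-- path that starts at distance h + 1 below the diagonal at its first visit to distance h
-- gives ballot u (h + 1) = Σ_{k ≤ u} ballot k h · ballot (u - k) 0, so the sum in the theorem
-- is ballot (n - m - 1) (2m + 1). The recurrence of ballot numbers yields the closed form
-- ballot u h = (h + 1) (2u + h)! / (u! (u + h + 1)!), and the theorem is the ratio
-- ballot (u + 1) h / ballot u (h + 1) it implies, taken at h = 2m.
module Submission where

open import Data.Bool using (Bool; true; false; _∧_)
open import Data.Bool.Properties using (∧-zeroʳ; T-≡)
open import Data.Empty using (⊥-elim)
open import Data.Integer.Base as ℤ using (ℤ; +_; -_; _≤ᵇ_; ∣_∣)
import Data.Integer.Properties as ℤ
open import Data.List using (List; []; _∷_; _++_; map; length; filterᵇ; applyUpTo; upTo)
open import Data.List.Properties using (length-++; filter-++; map-cong; map-upTo)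
open import Data.Nat using (ℕ; zero; suc; _+_; _*_; _∸_; _<_; _≤_; _!; z≤n; NonZero; >-nonZero)
open import Data.Nat.ListAction using (sum)
import Data.Nat.Properties as ℕ
open import Algebra.Properties.CommutativeSemigroup ℕ.*-commutativeSemigroup using (x∙yz≈y∙xz)
open import Algebra.Properties.CommutativeSemigroup ℕ.+-commutativeSemigroup
  using () renaming (x∙yz≈y∙xz to +-left-comm; interchange to +-interchange)
open import Data.Nat.Tactic.RingSolver using (solve-∀)
open import Function using (_∘_; Equivalence)
open import Relation.Binary.PropositionalEquality
  using (_≡_; _≢_; refl; subst; sym; trans; cong; cong₂; module ≡-Reasoning)
open import Relation.Nullary.Decidable using (⌊_⌋; T?; dec-true; dec-false; isYes≗does)

open import Defs

open ≡-Reasoning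

count : ∀ {A : Set} → (A → Bool) → List A → ℕ
count p xs = length (filterᵇ p xs)

module _ {A : Set} where

  count-++ : ∀ (p : A → Bool) xs ys → count p (xs ++ ys) ≡ count p xs + count p ys
  count-++ p xs ys =
    trans (cong length (filter-++ (T? ∘ p) xs ys)) (length-++ (filterᵇ p xs))

  count-map : ∀ {B : Set} (p : B → Bool) (f : A → B) xs → count p (map f xs) ≡ count (p ∘ f) xs
  count-map p f []       = refl
  count-map p f (x ∷ xs) with p (f x)
  ... | true  = cong suc (count-map p f xs)
  ... | false = count-map p f xs

  count-none : ∀ {p : A → Bool} → (∀ x → p x ≡ false) → ∀ xs → count p xs ≡ 0
  count-none p≡false []       = refl
  count-none p≡false (x ∷ xs) rewrite p≡false x = count-none p≡false xs

≤ᵇ-true : ∀ {i j} → i ℤ.≤ j → (i ≤ᵇ j) ≡ true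
≤ᵇ-true = Equivalence.to T-≡ ∘ ℤ.≤⇒≤ᵇ

≤ᵇ-false : ∀ {i j} → j ℤ.< i → (i ≤ᵇ j) ≡ false
≤ᵇ-false {i} {j} j<i with i ≤ᵇ j in eq
... | false = refl
... | true  = ⊥-elim (ℤ.<⇒≱ j<i (ℤ.≤ᵇ⇒≤ (Equivalence.from T-≡ eq)))

i<i+1 : ∀ i → i ℤ.< i ℤ.+ + 1
i<i+1 i = ℤ.suc[i]≤j⇒i<j (ℤ.≤-reflexive (ℤ.+-comm (+ 1) i))

⌊≟⌋-refl : ∀ i → ⌊ i ℤ.≟ i ⌋ ≡ true
⌊≟⌋-refl i = trans (isYes≗does (i ℤ.≟ i)) (dec-true (i ℤ.≟ i) refl)

⌊≟⌋-false : ∀ {i j} → i ≢ j → ⌊ i ℤ.≟ j ⌋ ≡ false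
⌊≟⌋-false {i} {j} i≢j = trans (isYes≗does (i ℤ.≟ j)) (dec-false (i ℤ.≟ j) i≢j)

pathCount : ℤ → ℤ → ℤ → ℕ → ℕ
pathCount t p q L = count (λ ss → goodPath p q ss t t) (allSteps L)

pathCount-origin : ∀ t → pathCount t t t 0 ≡ 1
pathCount-origin t rewrite ≤ᵇ-true (ℤ.≤-refl {t}) | ⌊≟⌋-refl t = refl

pathCount-step : ∀ {t p q} L → q ℤ.≤ p →
  pathCount t p q (suc L) ≡ pathCount t (p ℤ.+ + 1) q L + pathCount t p (q ℤ.+ + 1) L
pathCount-step {t} {p} {q} L q≤p = begin
  count good (map (true ∷_) paths ++ map (false ∷_) paths)
    ≡⟨ count-++ good (map (true ∷_) paths) _ ⟩
  count good (map (true ∷_) paths) + count good (map (false ∷_) paths)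
    ≡⟨ cong₂ _+_ (count-map good (true ∷_) paths) (count-map good (false ∷_) paths) ⟩
  count (λ ss → (q ≤ᵇ p) ∧ goodPath (p ℤ.+ + 1) q ss t t) paths
    + count (λ ss → (q ≤ᵇ p) ∧ goodPath p (q ℤ.+ + 1) ss t t) paths
    ≡⟨ cong (λ b → count (λ ss → b ∧ goodPath (p ℤ.+ + 1) q ss t t) paths
                   + count (λ ss → b ∧ goodPath p (q ℤ.+ + 1) ss t t) paths)
            (≤ᵇ-true q≤p) ⟩
  pathCount t (p ℤ.+ + 1) q L + pathCount t p (q ℤ.+ + 1) L ∎
  where
  good = λ ss → goodPath p q ss t t
  paths = allSteps L

goodPath-pastTarget : ∀ {t p} q ss → t ℤ.< p → goodPath p q ss t t ≡ false
goodPath-pastTarget {t} {p} q [] t<p =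
  trans (cong (λ b → (q ≤ᵇ p) ∧ b ∧ ⌊ q ℤ.≟ t ⌋) (⌊≟⌋-false (ℤ.<⇒≢ t<p ∘ sym))) (∧-zeroʳ _)
goodPath-pastTarget {t} {p} q (true ∷ ss) t<p =
  trans (cong ((q ≤ᵇ p) ∧_) (goodPath-pastTarget q ss (ℤ.<-trans t<p (i<i+1 p)))) (∧-zeroʳ _)
goodPath-pastTarget {t} {p} q (false ∷ ss) t<p =
  trans (cong ((q ≤ᵇ p) ∧_) (goodPath-pastTarget (q ℤ.+ + 1) ss t<p)) (∧-zeroʳ _)

goodPath-aboveDiagonal : ∀ {t p q} ss → p ℤ.< q → goodPath p q ss t t ≡ false
goodPath-aboveDiagonal []          p<q rewrite ≤ᵇ-false p<q = refl
goodPath-aboveDiagonal (true ∷ _)  p<q rewrite ≤ᵇ-false p<q = refl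
goodPath-aboveDiagonal (false ∷ _) p<q rewrite ≤ᵇ-false p<q = refl

pathCount-pastTarget : ∀ {t p} q L → t ℤ.< p → pathCount t p q L ≡ 0
pathCount-pastTarget q L t<p = count-none (λ ss → goodPath-pastTarget q ss t<p) (allSteps L)

pathCount-aboveDiagonal : ∀ {t p q} L → p ℤ.< q → pathCount t p q L ≡ 0
pathCount-aboveDiagonal L p<q = count-none (λ ss → goodPath-aboveDiagonal ss p<q) (allSteps L)

ballot : ℕ → ℕ → ℕ
ballot zero    h       = 1
ballot (suc u) zero    = ballot u 1
ballot (suc u) (suc h) = ballot u (suc (suc h)) + ballot (suc u) h

i+[1+n]≡i+1+n : ∀ i n → i ℤ.+ + suc n ≡ i ℤ.+ + 1 ℤ.+ + n
i+[1+n]≡i+1+n i n = sym (ℤ.+-assoc i (+ 1) (+ n))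

i+n+1≡i+[1+n] : ∀ i n → i ℤ.+ + n ℤ.+ + 1 ≡ i ℤ.+ + suc n
i+n+1≡i+[1+n] i n = trans (ℤ.+-assoc i (+ n) (+ 1)) (cong (λ k → i ℤ.+ + k) (ℕ.+-comm n 1))

m+[1+m]+n≡m+m+[1+n] : ∀ u h → u + suc u + h ≡ u + u + suc h
m+[1+m]+n≡m+m+[1+n] u h = trans (cong (_+ h) (ℕ.+-suc u u)) (sym (ℕ.+-suc (u + u) h))

j≤j+n : ∀ {i j} n → i ≡ j ℤ.+ + n → j ℤ.≤ i
j≤j+n {j = j} n i≡j+n = subst (j ℤ.≤_) (sym i≡j+n) (ℤ.i≤i+j j (+ n))

pathCount-ballot : ∀ u h {t p q} → t ≡ p ℤ.+ + u → p ≡ q ℤ.+ + h →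
  pathCount t p q (u + u + h) ≡ ballot u h
pathCount-ballot zero zero {t} {p} {q} t≡p+0 p≡q+0
  with trans t≡p+0 (ℤ.+-identityʳ p) | trans p≡q+0 (ℤ.+-identityʳ q)
... | refl | refl = pathCount-origin q
pathCount-ballot zero (suc h) {t} {p} {q} t≡p+0 p≡q+h+1 = begin
  pathCount t p q (suc h)
    ≡⟨ pathCount-step h (j≤j+n (suc h) p≡q+h+1) ⟩
  pathCount t (p ℤ.+ + 1) q h + pathCount t p (q ℤ.+ + 1) h
    ≡⟨ cong₂ _+_ (pathCount-pastTarget q h t<p+1)
                 (pathCount-ballot zero h t≡p+0 (trans p≡q+h+1 (i+[1+n]≡i+1+n q h))) ⟩
  0 + 1 ∎
  where
  t<p+1 : t ℤ.< p ℤ.+ + 1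
  t<p+1 = ℤ.≤-<-trans (ℤ.≤-reflexive (trans t≡p+0 (ℤ.+-identityʳ p))) (i<i+1 p)
pathCount-ballot (suc u) zero {t} {p} {q} t≡p+u+1 p≡q+0 = begin
  pathCount t p q (suc L)
    ≡⟨ pathCount-step L (j≤j+n 0 p≡q+0) ⟩
  pathCount t (p ℤ.+ + 1) q L + pathCount t p (q ℤ.+ + 1) L
    ≡⟨ cong₂ _+_ (trans (cong (pathCount t (p ℤ.+ + 1) q) (m+[1+m]+n≡m+m+[1+n] u 0))
                        (pathCount-ballot u 1 t≡p+1+u p+1≡q+1))
                 (pathCount-aboveDiagonal L p<q+1) ⟩
  ballot u 1 + 0
    ≡⟨ ℕ.+-identityʳ _ ⟩
  ballot u 1 ∎
  where
  L = u + suc u + 0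
  t≡p+1+u : t ≡ p ℤ.+ + 1 ℤ.+ + u
  t≡p+1+u = trans t≡p+u+1 (i+[1+n]≡i+1+n p u)
  p+1≡q+1 : p ℤ.+ + 1 ≡ q ℤ.+ + 1
  p+1≡q+1 = trans (cong (ℤ._+ + 1) p≡q+0) (i+n+1≡i+[1+n] q 0)
  p<q+1 : p ℤ.< q ℤ.+ + 1
  p<q+1 = subst (ℤ._< q ℤ.+ + 1) (sym (trans p≡q+0 (ℤ.+-identityʳ q))) (i<i+1 q)
pathCount-ballot (suc u) (suc h) {t} {p} {q} t≡p+u+1 p≡q+h+1 = begin
  pathCount t p q (suc L)
    ≡⟨ pathCount-step L (j≤j+n (suc h) p≡q+h+1) ⟩
  pathCount t (p ℤ.+ + 1) q L + pathCount t p (q ℤ.+ + 1) L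
    ≡⟨ cong₂ _+_ (trans (cong (pathCount t (p ℤ.+ + 1) q) (m+[1+m]+n≡m+m+[1+n] u (suc h)))
                        (pathCount-ballot u (suc (suc h)) t≡p+1+u p+1≡q+h+2))
                 (trans (cong (pathCount t p (q ℤ.+ + 1)) (ℕ.+-suc (u + suc u) h))
                        (pathCount-ballot (suc u) h t≡p+u+1 p≡q+1+h)) ⟩
  ballot u (suc (suc h)) + ballot (suc u) h ∎
  where
  L = u + suc u + suc h
  t≡p+1+u : t ≡ p ℤ.+ + 1 ℤ.+ + u
  t≡p+1+u = trans t≡p+u+1 (i+[1+n]≡i+1+n p u)
  p+1≡q+h+2 : p ℤ.+ + 1 ≡ q ℤ.+ + suc (suc h)
  p+1≡q+h+2 = trans (cong (ℤ._+ + 1) p≡q+h+1) (i+n+1≡i+[1+n] q (suc h))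
  p≡q+1+h : p ≡ q ℤ.+ + 1 ℤ.+ + h
  p≡q+1+h = trans p≡q+h+1 (i+[1+n]≡i+1+n q h)

𝒞≡ballot : ∀ {n m} → m ≤ n → 𝒞 n m ≡ ballot (n ∸ m) (2 * m)
𝒞≡ballot {n} {m} m≤n = begin
  pathCount t (+ 0) (- + (2 * m)) ∣ (t ℤ.- + 0) ℤ.+ (t ℤ.- - + (2 * m)) ∣
    ≡⟨ cong (pathCount t (+ 0) (- + (2 * m))) length≡ ⟩
  pathCount t (+ 0) (- + (2 * m)) (n ∸ m + (n ∸ m) + 2 * m)
    ≡⟨ pathCount-ballot (n ∸ m) (2 * m) t≡n∸m (sym (ℤ.+-inverseˡ (+ (2 * m)))) ⟩
  ballot (n ∸ m) (2 * m) ∎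
  where
  t = + n ℤ.- + m
  t≡n∸m : t ≡ + (n ∸ m)
  t≡n∸m = trans (ℤ.m-n≡m⊖n n m) (ℤ.⊖-≥ m≤n)
  length≡ : ∣ (t ℤ.- + 0) ℤ.+ (t ℤ.- - + (2 * m)) ∣ ≡ n ∸ m + (n ∸ m) + 2 * m
  length≡ rewrite t≡n∸m | ℤ.neg-involutive (+ (2 * m)) =
    trans (cong (_+ (n ∸ m + 2 * m)) (ℕ.+-identityʳ (n ∸ m))) (sym (ℕ.+-assoc (n ∸ m) _ _))

ballotNumerator : ℕ → ℕ → ℕ
ballotNumerator u h = suc h * (u + u + h) !

ballotDenominator : ℕ → ℕ → ℕ
ballotDenominator u h = u ! * suc (u + h) !

ballotDenominator-nonZero : ∀ u h → NonZero (ballotDenominator u h)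
ballotDenominator-nonZero u h = ℕ.m*n≢0 (u !) _ {{u ℕ.!≢0}} {{suc (u + h) ℕ.!≢0}}

ballotDenominator-sucˡ : ∀ u h → ballotDenominator (suc u) h ≡ suc u * ballotDenominator u (suc h)
ballotDenominator-sucˡ u h rewrite ℕ.+-suc u h = ℕ.*-assoc (suc u) (u !) _

ballotDenominator-sucʳ : ∀ u h → ballotDenominator u (suc h) ≡ (2 + u + h) * ballotDenominator u h
ballotDenominator-sucʳ u h rewrite ℕ.+-suc u h = x∙yz≈y∙xz (u !) (2 + u + h) _

ballotNumerator-suc-zero : ∀ u → ballotNumerator (suc u) 0 ≡ suc u * ballotNumerator u 1
ballotNumerator-suc-zero u
  rewrite ℕ.+-suc u u | ℕ.+-suc (u + u) 0 = factor-2 u (suc (u + u + 0) !)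
  where
  factor-2 : ∀ u x → 1 * ((2 + (u + u + 0)) * x) ≡ suc u * (2 * x)
  factor-2 = solve-∀

ballotNumerator-suc-suc : ∀ u h → ballotNumerator (suc u) (suc h)
  ≡ suc u * ballotNumerator u (2 + h) + (3 + u + h) * ballotNumerator (suc u) h
ballotNumerator-suc-suc u h
  rewrite ℕ.+-suc u u | ℕ.+-suc (u + u) (suc h) | ℕ.+-suc (u + u) h =
  split u h (suc (suc (u + u + h)) !)
  where
  split : ∀ u h x →
    (2 + h) * ((3 + (u + u + h)) * x) ≡ suc u * ((3 + h) * x) + (3 + u + h) * (suc h * x)
  split = solve-∀

ballotNumerator-ratio : ∀ u h →
  (2 + h) * ballotNumerator (suc u) h ≡ suc h * (2 + (u + u + h)) * ballotNumerator u (suc h)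
ballotNumerator-ratio u h rewrite ℕ.+-suc u u | ℕ.+-suc (u + u) h =
  regroup h (u + u + h) (suc (u + u + h) !)
  where
  regroup : ∀ h w x → (2 + h) * (suc h * ((2 + w) * x)) ≡ suc h * (2 + w) * ((2 + h) * x)
  regroup = solve-∀

ballot-closedForm : ∀ u h → ballot u h * ballotDenominator u h ≡ ballotNumerator u h
ballot-closedForm zero h = trans (ℕ.*-identityˡ _) (ℕ.*-identityˡ _)
ballot-closedForm (suc u) zero = begin
  ballot u 1 * ballotDenominator (suc u) 0     ≡⟨ cong (ballot u 1 *_) (ballotDenominator-sucˡ u 0) ⟩
  ballot u 1 * (suc u * ballotDenominator u 1) ≡⟨ x∙yz≈y∙xz (ballot u 1) (suc u) _ ⟩
  suc u * (ballot u 1 * ballotDenominator u 1) ≡⟨ cong (suc u *_) (ballot-closedForm u 1) ⟩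
  suc u * ballotNumerator u 1                  ≡⟨ ballotNumerator-suc-zero u ⟨
  ballotNumerator (suc u) 0                    ∎
ballot-closedForm (suc u) (suc h) = begin
  (b₁ + b₂) * d
    ≡⟨ ℕ.*-distribʳ-+ d b₁ b₂ ⟩
  b₁ * d + b₂ * d
    ≡⟨ cong₂ _+_ (cong (b₁ *_) (ballotDenominator-sucˡ u (suc h)))
                 (cong (b₂ *_) (ballotDenominator-sucʳ (suc u) h)) ⟩
  b₁ * (suc u * ballotDenominator u (2 + h)) + b₂ * ((3 + u + h) * ballotDenominator (suc u) h)
    ≡⟨ cong₂ _+_ (x∙yz≈y∙xz b₁ (suc u) _) (x∙yz≈y∙xz b₂ (3 + u + h) _) ⟩
  suc u * (b₁ * ballotDenominator u (2 + h)) + (3 + u + h) * (b₂ * ballotDenominator (suc u) h)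
    ≡⟨ cong₂ (λ x y → suc u * x + (3 + u + h) * y)
             (ballot-closedForm u (2 + h)) (ballot-closedForm (suc u) h) ⟩
  suc u * ballotNumerator u (2 + h) + (3 + u + h) * ballotNumerator (suc u) h
    ≡⟨ ballotNumerator-suc-suc u h ⟨
  ballotNumerator (suc u) (suc h) ∎
  where
  b₁ = ballot u (2 + h)
  b₂ = ballot (suc u) h
  d = ballotDenominator (suc u) (suc h)

ballot-ratio : ∀ u h →
  suc u * (2 + h) * ballot (suc u) h ≡ suc h * (2 + (u + u + h)) * ballot u (suc h)
ballot-ratio u h = ℕ.*-cancelʳ-≡ _ _ d {{ballotDenominator-nonZero u (suc h)}} (begin
  suc u * (2 + h) * ballot (suc u) h * d        ≡⟨ regroup (suc u) (2 + h) (ballot (suc u) h) d ⟩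
  (2 + h) * (ballot (suc u) h * (suc u * d))    ≡⟨ cong (λ x → (2 + h) * (ballot (suc u) h * x))
                                                        (ballotDenominator-sucˡ u h) ⟨
  (2 + h) * (ballot (suc u) h * ballotDenominator (suc u) h)
                                                ≡⟨ cong ((2 + h) *_) (ballot-closedForm (suc u) h) ⟩
  (2 + h) * ballotNumerator (suc u) h           ≡⟨ ballotNumerator-ratio u h ⟩
  c * ballotNumerator u (suc h)                 ≡⟨ cong (c *_) (ballot-closedForm u (suc h)) ⟨
  c * (ballot u (suc h) * d)                    ≡⟨ ℕ.*-assoc c (ballot u (suc h)) d ⟨
  c * ballot u (suc h) * d                      ∎)
  where
  d = ballotDenominator u (suc h)
  c = suc h * (2 + (u + u + h))
  regroup : ∀ a b x y → a * b * x * y ≡ b * (x * (a * y))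
  regroup = solve-∀

catalan : ℕ → ℕ
catalan u = ballot u 0

convolution : (ℕ → ℕ) → (ℕ → ℕ) → ℕ → ℕ
convolution f g N = sum (applyUpTo (λ k → f k * g (N ∸ k ∸ 1)) N)

convolution-+ : ∀ f f′ g N →
  convolution (λ k → f k + f′ k) g N ≡ convolution f g N + convolution f′ g N
convolution-+ f f′ g zero    = refl
convolution-+ f f′ g (suc N) = begin
  (f 0 + f′ 0) * g N + convolution (λ k → f (suc k) + f′ (suc k)) g N
    ≡⟨ cong₂ _+_ (ℕ.*-distribʳ-+ (g N) (f 0) (f′ 0)) (convolution-+ (f ∘ suc) (f′ ∘ suc) g N) ⟩
  (f 0 * g N + f′ 0 * g N) + (convolution (f ∘ suc) g N + convolution (f′ ∘ suc) g N)
    ≡⟨ +-interchange (f 0 * g N) _ _ _ ⟩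
  (f 0 * g N + convolution (f ∘ suc) g N) + (f′ 0 * g N + convolution (f′ ∘ suc) g N) ∎

ballot⋆catalan : ℕ → ℕ → ℕ
ballot⋆catalan h = convolution (λ k → ballot k h) catalan

ballot⋆catalan-suc-suc : ∀ h u →
  ballot⋆catalan (suc h) (suc u) ≡ ballot⋆catalan (2 + h) u + ballot⋆catalan h (suc u)
ballot⋆catalan-suc-suc h u = begin
  -- both sides unfold to a leading term ballot 0 _ * catalan u, where ballot 0 _ = 1
  1 * catalan u + convolution (λ k → ballot k (2 + h) + ballot (suc k) h) catalan u
    ≡⟨ cong (_+_ (1 * catalan u))
            (convolution-+ (λ k → ballot k (2 + h)) (λ k → ballot (suc k) h) catalan u) ⟩
  1 * catalan u + (ballot⋆catalan (2 + h) u + convolution (λ k → ballot (suc k) h) catalan u)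
    ≡⟨ +-left-comm (1 * catalan u) (ballot⋆catalan (2 + h) u) _ ⟩
  ballot⋆catalan (2 + h) u + ballot⋆catalan h (suc u) ∎

mutual
  ballot-sucʳ : ∀ u h → ballot u (suc h) ≡ ballot u h + ballot⋆catalan (suc h) u
  ballot-sucʳ zero    h = refl
  ballot-sucʳ (suc u) h =
    trans (cong (_+ ballot (suc u) h) (ballot-firstPassage u (suc h)))
          (ℕ.+-comm (ballot⋆catalan (suc h) (suc u)) (ballot (suc u) h))

  ballot-firstPassage : ∀ u h → ballot u (suc h) ≡ ballot⋆catalan h (suc u)
  ballot-firstPassage u zero =
    trans (ballot-sucʳ u 0) (cong (_+ ballot⋆catalan 1 u) (sym (ℕ.*-identityˡ (catalan u))))
  ballot-firstPassage u (suc h) = begin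
    ballot u (2 + h)
      ≡⟨ ballot-sucʳ u (suc h) ⟩
    ballot u (suc h) + ballot⋆catalan (2 + h) u
      ≡⟨ cong (_+ ballot⋆catalan (2 + h) u) (ballot-firstPassage u h) ⟩
    ballot⋆catalan h (suc u) + ballot⋆catalan (2 + h) u
      ≡⟨ ℕ.+-comm (ballot⋆catalan h (suc u)) _ ⟩
    ballot⋆catalan (2 + h) u + ballot⋆catalan h (suc u)
      ≡⟨ ballot⋆catalan-suc-suc h u ⟨
    ballot⋆catalan (suc h) (suc u) ∎

ballot-convolution : ∀ {N} m → .{{NonZero N}} →
  N * (m + 1) * ballot N (2 * m) ≡ (m + N) * (2 * m + 1) * ballot⋆catalan (2 * m) N
ballot-convolution {suc N} m = ℕ.*-cancelˡ-≡ _ _ 2 (begin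
  2 * (suc N * (m + 1) * ballot (suc N) (2 * m))
    ≡⟨ double-left N m (ballot (suc N) (2 * m)) ⟩
  suc N * (2 + 2 * m) * ballot (suc N) (2 * m)
    ≡⟨ ballot-ratio N (2 * m) ⟩
  suc (2 * m) * (2 + (N + N + 2 * m)) * ballot N (suc (2 * m))
    ≡⟨ double-right N m (ballot N (suc (2 * m))) ⟨
  2 * ((m + suc N) * (2 * m + 1) * ballot N (suc (2 * m)))
    ≡⟨ cong (λ x → 2 * ((m + suc N) * (2 * m + 1) * x)) (ballot-firstPassage N (2 * m)) ⟩
  2 * ((m + suc N) * (2 * m + 1) * ballot⋆catalan (2 * m) (suc N)) ∎)
  where
  double-left : ∀ N m x → 2 * (suc N * (m + 1) * x) ≡ suc N * (2 + 2 * m) * x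
  double-left = solve-∀
  double-right : ∀ N m x →
    2 * ((m + suc N) * (2 * m + 1) * x) ≡ suc (2 * m) * (2 + (N + N + 2 * m)) * x
  double-right = solve-∀

sum-𝒞≡ballot⋆catalan : ∀ m N →
  sum (map (λ k → 𝒞 (k + m) m * 𝒞 (N ∸ k ∸ 1) 0) (upTo N)) ≡ ballot⋆catalan (2 * m) N
sum-𝒞≡ballot⋆catalan m N =
  trans (cong sum (map-cong termwise (upTo N))) (cong sum (map-upTo _ N))
  where
  termwise : ∀ k → 𝒞 (k + m) m * 𝒞 (N ∸ k ∸ 1) 0 ≡ ballot k (2 * m) * catalan (N ∸ k ∸ 1)
  termwise k = cong₂ _*_
    (trans (𝒞≡ballot (ℕ.m≤n+m m k)) (cong (λ i → ballot i (2 * m)) (ℕ.m+n∸n≡m k m)))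
    (𝒞≡ballot {N ∸ k ∸ 1} z≤n)

theorem5p1 : (n m : ℕ) → m < n →
    (n ∸ m) * (m + 1) * 𝒞 n m
      ≡ n * (2 * m + 1) * sum (map (λ k → 𝒞 (k + m) m * 𝒞 (n ∸ m ∸ k ∸ 1) 0) (upTo (n ∸ m)))
theorem5p1 n m m<n = begin
  (n ∸ m) * (m + 1) * 𝒞 n m
    ≡⟨ cong ((n ∸ m) * (m + 1) *_) (𝒞≡ballot m≤n) ⟩
  (n ∸ m) * (m + 1) * ballot (n ∸ m) (2 * m)
    ≡⟨ ballot-convolution m {{>-nonZero (ℕ.m<n⇒0<n∸m m<n)}} ⟩
  (m + (n ∸ m)) * (2 * m + 1) * ballot⋆catalan (2 * m) (n ∸ m)
    ≡⟨ cong (λ k → k * (2 * m + 1) * ballot⋆catalan (2 * m) (n ∸ m)) (ℕ.m+[n∸m]≡n m≤n) ⟩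
  n * (2 * m + 1) * ballot⋆catalan (2 * m) (n ∸ m)
    ≡⟨ cong (n * (2 * m + 1) *_) (sum-𝒞≡ballot⋆catalan m (n ∸ m)) ⟨
  n * (2 * m + 1) * sum (map (λ k → 𝒞 (k + m) m * 𝒞 (n ∸ m ∸ k ∸ 1) 0) (upTo (n ∸ m))) ∎
  where
  m≤n : m ≤ n
  m≤n = ℕ.<⇒≤ m<n
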